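{- Let $Q_1$ be a quiver on vertex set $[N_1]$ and $Q_2$ a quiver on vertex set $[N_1+1,N_1+N_2]$. Let $a_1,\dots,a_s\in(Q_1)_0$ be distinct vertices and, for each $j\in[s]$, let $B_j\subseteq (Q_2)_0$ be a set of (distinct) vertices. Let $Q$ be the quiver obtained from the disjoint union of $Q_1$ and $Q_2$ by adding exactly one arrow $a_j\to b$ for each $j\in[s]$ and each $b\in B_j$ (that is, $Q=Q_1\oplus_{(a_1,\dots,a_1,\dots,a_s,\dots,a_s)}^{(B_1,\dots,B_s)}Q_2$, an $s$-colored direct sum). If $\underline{\mu}_1\in\mathrm{green}(Q_1)$ and $\underline{\mu}_2\in\mathrm{green}(Q_2)$, then $\underline{\mu}_2\circ\underline{\mu}_1\in\mathrm{green}(Q)$.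
   Context: A quiver is a finite directed graph with no loops and no 2-cycles. Mutation $\mu_k$ at a (non-frozen) vertex $k$: for each 2-path $i\to k\to j$ add an arrow $i\to j$, reverse all arrows incident to $k$, then delete 2-cycles. Mutation sequences are applied right to left (so in $\underline{\mu}_2\circ\underline{\mu}_1$, $\underline{\mu}_1$ is applied first). For a quiver $Q$ on vertices $[N]$, the framed quiver $\widehat{Q}$ is obtained by adjoining frozen vertices $1',\dots,N'$ and arrows $i\to i'$; frozen vertices are never mutated. In a quiver obtained from $\widehat{Q}$ by mutations, a mutable vertex $i$ is green if all arrows between $i$ and frozen vertices point away from $i$, and red if they all point towards $i$. A green sequence is a mutation sequence at mutable vertices in which each mutation is performed at a vertex that is green at that moment; it is maximal if at the end all mutable vertices are red. $\mathrm{green}(Q)$ denotes the set of maximal green sequences of $\widehat{Q}$. Mutation sequences of $Q_1$ and $Q_2$ are regarded as mutation sequences of $Q$ via the inclusion of vertex sets. -}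

module Defs where

open import Data.Nat using (ℕ; zero; suc; _+_; _*_; _∸_)
open import Data.Fin using (Fin; zero; suc; _↑ˡ_; _↑ʳ_; splitAt)
open import Data.Fin.Properties using (_≟_)
open import Data.Fin.Subset using (Subset; _∈_)
open import Data.Fin.Subset.Properties using (_∈?_)
open import Data.Sum using (_⊎_; inj₁; inj₂)
import Data.Sum.Properties as SumP
open import Data.Product using (_×_)
open import Data.List using (List; []; _∷_; map; _++_)
open import Function.Definitions using (Injective)
open import Relation.Binary.PropositionalEquality using (_≡_)
open import Relation.Nullary using (yes; no)

-- A (multi)graph on vertex type V: q i j = number of arrows i → j.
Arrows : Set → Set
Arrows V = V → V → ℕ

IsQuiver : {V : Set} → Arrows V → Set
IsQuiver {V} q = (∀ (i : V) → q i i ≡ 0) × (∀ (i j : V) → (q i j ≡ 0) ⊎ (q j i ≡ 0))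

-- Ice quivers arising from framings: mutable vertices inj₁ i, frozen vertices inj₂ i'.
IceV : ℕ → Set
IceV n = Fin n ⊎ Fin n

_≟V_ : ∀ {n} (u v : IceV n) → Relation.Nullary.Dec (u ≡ v)
_≟V_ = SumP.≡-dec _≟_ _≟_

-- Mutation at mutable vertex k:
--  * arrows incident to k are reversed;
--  * for i, j ≠ k: first add q i k * q k j arrows i → j (one per 2-path i → k → j),
--    then delete 2-cycles (keep c i j ∸ c j i arrows i → j).
mutate : ∀ {n} → Arrows (IceV n) → Fin n → Arrows (IceV n)
mutate q k i j with i ≟V inj₁ k | j ≟V inj₁ k
... | yes _ | _     = q j i
... | no _  | yes _ = q j i
... | no _  | no _  = c i j ∸ c j i
  where
  c : IceV _ → IceV _ → ℕ
  c x y = q x y + q x (inj₁ k) * q (inj₁ k) y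

-- Mutation sequence, listed in order of application (head applied first).
mutateSeq : ∀ {n} → Arrows (IceV n) → List (Fin n) → Arrows (IceV n)
mutateSeq q []       = q
mutateSeq q (k ∷ ks) = mutateSeq (mutate q k) ks

framed : ∀ {n} → Arrows (Fin n) → Arrows (IceV n)
framed q (inj₁ i) (inj₁ j) = q i j
framed q (inj₁ i) (inj₂ j) with i ≟ j
... | yes _ = 1
... | no _  = 0
framed q (inj₂ i) _ = 0

Green : ∀ {n} → Arrows (IceV n) → Fin n → Set
Green q i = ∀ f → q (inj₂ f) (inj₁ i) ≡ 0

Red : ∀ {n} → Arrows (IceV n) → Fin n → Set
Red q i = ∀ f → q (inj₁ i) (inj₂ f) ≡ 0

data GreenSeq {n : ℕ} : Arrows (IceV n) → List (Fin n) → Set where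
  []  : ∀ {q} → GreenSeq q []
  _∷_ : ∀ {q k ks} → Green q k → GreenSeq (mutate q k) ks → GreenSeq q (k ∷ ks)

MaxGreen : ∀ {n} → Arrows (Fin n) → List (Fin n) → Set
MaxGreen q μ = GreenSeq (framed q) μ × (∀ i → Red (mutateSeq (framed q) μ) i)

sumFin : (s : ℕ) → (Fin s → ℕ) → ℕ
sumFin zero    f = 0
sumFin (suc s) f = f zero + sumFin s (λ j → f (suc j))

-- s-colored direct sum Q₁ ⊕ Q₂ on [N₁ + N₂]; Q₂'s vertex b ∈ Fin N₂ is N₁ + b.
-- Extra arrows: one arrow a_j → b for each j ∈ [s] and b ∈ B_j.
directSum : (N₁ N₂ s : ℕ) → Arrows (Fin N₁) → Arrows (Fin N₂)
          → (Fin s → Fin N₁) → (Fin s → Subset N₂) → Arrows (Fin (N₁ + N₂))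
directSum N₁ N₂ s q₁ q₂ a B u v with splitAt N₁ u | splitAt N₁ v
... | inj₁ x | inj₁ y = q₁ x y
... | inj₂ x | inj₂ y = q₂ x y
... | inj₂ x | inj₁ y = 0
... | inj₁ x | inj₂ y = sumFin s λ j → extra (a j ≟ x) (y ∈? B j)
  where
  extra : ∀ {P R : Set} → Relation.Nullary.Dec P → Relation.Nullary.Dec R → ℕ
  extra (yes _) (yes _) = 1
  extra _       _       = 0

embed₁ : ∀ {N₁} N₂ → List (Fin N₁) → List (Fin (N₁ + N₂))
embed₁ N₂ = map (λ i → i ↑ˡ N₂)

embed₂ : ∀ N₁ {N₂} → List (Fin N₂) → List (Fin (N₁ + N₂))
embed₂ N₁ = map (N₁ ↑ʳ_)

module Submission where

-- The colored direct sum Q = Q₁ ⊕ Q₂ is a *triangular extension*: the vertices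
-- split into two blocks inducing Q₁ and Q₂, and every arrow between the blocks
-- goes from the Q₁-block to the Q₂-block.  The statement holds for every
-- triangular extension (Concatenation.maxGreen); neither the injectivity of a
-- nor the shape of the connecting arrows plays a role.
--
-- Both halves of μ₂ ∘ μ₁ are handled by one analysis of a *phase*: mutations
-- inside an active block while a passive block is left alone (module Phase).
-- Its invariant says that the framed active block evolves as in its own framed
-- quiver, the framed passive block is untouched, each block's frozen vertices
-- are apart from the other block, and -- the heart of the argument -- the
-- column of each passive vertex, restricted to the active block, is a fixed
-- ℕ-combination of the frozen columns of the active block.  At a green vertex k
-- the frozen row of k is nonnegative, hence so are its passive entries; then
-- mutation at k is linear on these columns and never reaches the passive block.
-- Once the active block is red the same combination shows that no arrow leads
-- from the active to the passive block: this is the starting situation of the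
-- second phase, with the roles of the blocks exchanged.

open import Defs
open import Data.Nat using (ℕ; zero; suc; _+_; _*_; _∸_; z≤n)
import Data.Nat.Properties as ℕP
open import Data.Integer using (ℤ; +_; 0ℤ; -1ℤ; -_; _≤_; +≤+; _⊖_)
  renaming (_+_ to _+ᶻ_; _-_ to _-ᶻ_; _*_ to _*ᶻ_)
import Data.Integer.Properties as ℤP
open import Data.Integer.Tactic.RingSolver using (solve-∀)
open import Algebra.Properties.Semiring.Sum ℤP.+-*-semiring
  using (sum; sum-cong-≗; ∑-distrib-+; *-distribˡ-sum; sum-remove; sum-replicate-zero)
open import Data.Fin using (Fin; zero; suc; _↑ˡ_; _↑ʳ_; splitAt; punchIn)
open import Data.Fin.Properties
  using (_≟_; ↑ˡ-injective; ↑ʳ-injective; splitAt-↑ˡ; splitAt-↑ʳ; splitAt⁻¹-↑ˡ; splitAt⁻¹-↑ʳ; punchInᵢ≢i)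
open import Data.Fin.Subset using (Subset)
open import Data.List using (List; []; _∷_; _++_; map)
open import Data.Sum using (_⊎_; inj₁; inj₂)
import Data.Sum as Sum
open import Data.Sum.Properties using (inj₁-injective)
open import Data.Product using (_×_; _,_; ∃; proj₁; proj₂)
import Data.Product
open import Data.Empty using (⊥-elim)
open import Function using (_∘_)
open import Function.Definitions using (Injective)
open import Relation.Nullary using (Dec; yes; no)
open import Relation.Binary.PropositionalEquality

-- The signed number of arrows u → v, i.e. an entry of the exchange matrix.
signed : {V : Set} → Arrows V → V → V → ℤ
signed q u v = + q u v -ᶻ + q v u

NoTwoCycles : {V : Set} → Arrows V → Set
NoTwoCycles {V} q = (u v : V) → q u v ≡ 0 ⊎ q v u ≡ 0

Apart : {V : Set} → Arrows V → V → V → Set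
Apart q u v = q u v ≡ 0 × q v u ≡ 0

signed-nonneg : ∀ {V} (q : Arrows V) {u v} → q v u ≡ 0 → 0ℤ ≤ signed q u v
signed-nonneg q {u} {v} back rewrite back = +≤+ z≤n

signed-nonpos : ∀ {V} (q : Arrows V) {u v} → q u v ≡ 0 → signed q u v ≤ 0ℤ
signed-nonpos q {u} {v} forth rewrite forth =
  subst (_≤ 0ℤ) (sym (ℤP.+-identityˡ (- + q v u))) ℤP.neg-≤-pos

nonneg-no-reverse : ∀ {V} (q : Arrows V) {u v} →
  q u v ≡ 0 ⊎ q v u ≡ 0 → 0ℤ ≤ signed q u v → q v u ≡ 0
nonneg-no-reverse q {u} {v} = go (q u v) (q v u)
  where
  go : ∀ a b → a ≡ 0 ⊎ b ≡ 0 → 0ℤ ≤ + a -ᶻ + b → b ≡ 0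
  go a b (inj₂ b≡0) _ = b≡0
  go .0 zero (inj₁ refl) _ = refl
  go .0 (suc b) (inj₁ refl) ()

nonpos-no-forward : ∀ {V} (q : Arrows V) {u v} →
  q u v ≡ 0 ⊎ q v u ≡ 0 → signed q u v ≤ 0ℤ → q u v ≡ 0
nonpos-no-forward q {u} {v} = go (q u v) (q v u)
  where
  go : ∀ a b → a ≡ 0 ⊎ b ≡ 0 → + a -ᶻ + b ≤ 0ℤ → a ≡ 0
  go a b (inj₁ a≡0) _ = a≡0
  go zero .0 (inj₂ refl) _ = refl
  go (suc a) .0 (inj₂ refl) (+≤+ ())

-- Cancelling the 2-cycles between u and v does not change the signed count.
truncated-difference : ∀ a b → + (a ∸ b) -ᶻ + (b ∸ a) ≡ + a -ᶻ + b
truncated-difference zero zero = refl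
truncated-difference zero (suc b) = refl
truncated-difference (suc a) zero = refl
truncated-difference (suc a) (suc b) = begin
  + (a ∸ b) -ᶻ + (b ∸ a)     ≡⟨ truncated-difference a b ⟩
  + a -ᶻ + b                 ≡⟨ ℤP.m-n≡m⊖n a b ⟩
  a ⊖ b                      ≡⟨ sym (ℤP.[1+m]⊖[1+n]≡m⊖n a b) ⟩
  suc a ⊖ suc b              ≡⟨ sym (ℤP.m-n≡m⊖n (suc a) (suc b)) ⟩
  + suc a -ᶻ + suc b         ∎
  where open ≡-Reasoning

lincomb : ∀ {p} → (Fin p → ℕ) → (Fin p → ℤ) → ℤ
lincomb c X = sum (λ f → + c f *ᶻ X f)

lincomb-cong : ∀ {p} (c : Fin p → ℕ) {X Y : Fin p → ℤ} → (∀ f → X f ≡ Y f) → lincomb c X ≡ lincomb c Y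
lincomb-cong c e = sum-cong-≗ (λ f → cong (+ c f *ᶻ_) (e f))

scaled-distrib : ∀ w x y a → w *ᶻ (x +ᶻ a *ᶻ y) ≡ w *ᶻ x +ᶻ a *ᶻ (w *ᶻ y)
scaled-distrib = solve-∀

lincomb-linear : ∀ {p} (c : Fin p → ℕ) (X Y : Fin p → ℤ) (A : ℤ) →
  lincomb c (λ f → X f +ᶻ A *ᶻ Y f) ≡ lincomb c X +ᶻ A *ᶻ lincomb c Y
lincomb-linear c X Y A = begin
  sum (λ f → + c f *ᶻ (X f +ᶻ A *ᶻ Y f))
    ≡⟨ sum-cong-≗ (λ f → scaled-distrib (+ c f) (X f) (Y f) A) ⟩
  sum (λ f → + c f *ᶻ X f +ᶻ A *ᶻ (+ c f *ᶻ Y f))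
    ≡⟨ ∑-distrib-+ (λ f → + c f *ᶻ X f) (λ f → A *ᶻ (+ c f *ᶻ Y f)) ⟩
  lincomb c X +ᶻ sum (λ f → A *ᶻ (+ c f *ᶻ Y f))
    ≡⟨ cong (lincomb c X +ᶻ_) (sym (*-distribˡ-sum A (λ f → + c f *ᶻ Y f))) ⟩
  lincomb c X +ᶻ A *ᶻ lincomb c Y ∎
  where open ≡-Reasoning

lincomb-neg : ∀ {p} (c : Fin p → ℕ) (X : Fin p → ℤ) → lincomb c (λ f → - X f) ≡ - lincomb c X
lincomb-neg c X = begin
  sum (λ f → + c f *ᶻ - X f)     ≡⟨ sum-cong-≗ (λ f → sym (ℤP.neg-distribʳ-* (+ c f) (X f))) ⟩
  sum (λ f → - (+ c f *ᶻ X f))   ≡⟨ sum-cong-≗ (λ f → sym (ℤP.-1*i≡-i (+ c f *ᶻ X f))) ⟩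
  sum (λ f → -1ℤ *ᶻ (+ c f *ᶻ X f)) ≡⟨ sym (*-distribˡ-sum -1ℤ (λ f → + c f *ᶻ X f)) ⟩
  -1ℤ *ᶻ lincomb c X               ≡⟨ ℤP.-1*i≡-i (lincomb c X) ⟩
  - lincomb c X                    ∎
  where open ≡-Reasoning

sum-mono-≤ : ∀ {p} {s t : Fin p → ℤ} → (∀ f → s f ≤ t f) → sum s ≤ sum t
sum-mono-≤ {zero} _ = ℤP.≤-refl
sum-mono-≤ {suc p} s≤t = ℤP.+-mono-≤ (s≤t zero) (sum-mono-≤ (s≤t ∘ suc))

lincomb-mono-≤ : ∀ {p} (c : Fin p → ℕ) {X Y : Fin p → ℤ} → (∀ f → X f ≤ Y f) → lincomb c X ≤ lincomb c Y
lincomb-mono-≤ c X≤Y = sum-mono-≤ (λ f → ℤP.*-monoˡ-≤-nonNeg (+ c f) (X≤Y f))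

lincomb-zero : ∀ {p} (c : Fin p → ℕ) → lincomb c (λ _ → 0ℤ) ≡ 0ℤ
lincomb-zero {p} c = trans (sum-cong-≗ (λ f → ℤP.*-zeroʳ (+ c f))) (sum-replicate-zero p)

lincomb-nonneg : ∀ {p} (c : Fin p → ℕ) {X : Fin p → ℤ} → (∀ f → 0ℤ ≤ X f) → 0ℤ ≤ lincomb c X
lincomb-nonneg c {X} 0≤X = subst (_≤ lincomb c X) (lincomb-zero c) (lincomb-mono-≤ c 0≤X)

lincomb-nonpos : ∀ {p} (c : Fin p → ℕ) {X : Fin p → ℤ} → (∀ f → X f ≤ 0ℤ) → lincomb c X ≤ 0ℤ
lincomb-nonpos c {X} X≤0 = subst (lincomb c X ≤_) (lincomb-zero c) (lincomb-mono-≤ c X≤0)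

lincomb-unit : ∀ {p} (c : Fin p → ℕ) (X : Fin p → ℤ) (k : Fin p) →
  X k ≡ + 1 → (∀ f → f ≢ k → X f ≡ 0ℤ) → lincomb c X ≡ + c k
lincomb-unit {suc p} c X k Xk≡1 X≡0 = begin
  lincomb c X                                  ≡⟨ sum-remove {i = k} t ⟩
  t k +ᶻ sum (λ j → t (punchIn k j))           ≡⟨ cong₂ _+ᶻ_ (cong (+ c k *ᶻ_) Xk≡1) rest-zero ⟩
  + c k *ᶻ + 1 +ᶻ 0ℤ                           ≡⟨ ℤP.+-identityʳ _ ⟩
  + c k *ᶻ + 1                                 ≡⟨ ℤP.*-identityʳ (+ c k) ⟩
  + c k                                        ∎
  where
  open ≡-Reasoning
  t : Fin (suc p) → ℤ
  t f = + c f *ᶻ X f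
  rest-zero : sum (λ j → t (punchIn k j)) ≡ 0ℤ
  rest-zero = trans (sum-cong-≗ (λ j → trans (cong (+ c (punchIn k j) *ᶻ_) (X≡0 _ (punchInᵢ≢i k j)))
                                             (ℤP.*-zeroʳ (+ c (punchIn k j)))))
                    (sum-replicate-zero p)

path-zero : ∀ {a b} → a ≡ 0 ⊎ b ≡ 0 → a * b ≡ 0
path-zero (inj₁ refl) = refl
path-zero {a} (inj₂ refl) = ℕP.*-zeroʳ a

module Mutation {n : ℕ} (q : Arrows (IceV n)) (k : Fin n) where

  K : IceV n
  K = inj₁ k

  q′ : Arrows (IceV n)
  q′ = mutate q k

  mutate-from-k : ∀ w → q′ K w ≡ q w K
  mutate-from-k w with K ≟V K
  ... | yes _ = refl
  ... | no K≢K = ⊥-elim (K≢K refl)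

  mutate-to-k : ∀ u → u ≢ K → q′ u K ≡ q K u
  mutate-to-k u u≢K with u ≟V K | K ≟V K
  ... | yes u≡K | _ = ⊥-elim (u≢K u≡K)
  ... | no _ | yes _ = refl
  ... | no _ | no K≢K = ⊥-elim (K≢K refl)

  mutate-away : ∀ u w → u ≢ K → w ≢ K →
    q′ u w ≡ (q u w + q u K * q K w) ∸ (q w u + q w K * q K u)
  mutate-away u w u≢K w≢K with u ≟V K | w ≟V K
  ... | yes u≡K | _ = ⊥-elim (u≢K u≡K)
  ... | no _ | yes w≡K = ⊥-elim (w≢K w≡K)
  ... | no _ | no _ = refl

  mutate-noTwoCycles : NoTwoCycles q → NoTwoCycles q′
  mutate-noTwoCycles noTwo u w = cases (u ≟V K) (w ≟V K)
    where
    cases : Dec (u ≡ K) → Dec (w ≡ K) → q′ u w ≡ 0 ⊎ q′ w u ≡ 0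
    cases (yes refl) (yes refl) = Sum.map (trans (mutate-from-k K)) (trans (mutate-from-k K)) (noTwo K K)
    cases (yes refl) (no w≢K) = Sum.map (trans (mutate-from-k w)) (trans (mutate-to-k w w≢K)) (noTwo w K)
    cases (no u≢K) (yes refl) = Sum.map (trans (mutate-to-k u u≢K)) (trans (mutate-from-k u)) (noTwo K u)
    cases (no u≢K) (no w≢K) rewrite mutate-away u w u≢K w≢K | mutate-away w u w≢K u≢K =
      Sum.map ℕP.m≤n⇒m∸n≡0 ℕP.m≤n⇒m∸n≡0 (ℕP.≤-total (q u w + q u K * q K w) (q w u + q w K * q K u))

  mutate-fixes : ∀ u w → u ≢ K → w ≢ K → q u K ≡ 0 ⊎ q K w ≡ 0 → q w K ≡ 0 ⊎ q K u ≡ 0 →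
    q u w ≡ 0 ⊎ q w u ≡ 0 → q′ u w ≡ q u w
  mutate-fixes u w u≢K w≢K no-uKw no-wKu noTwo = begin
    q′ u w
      ≡⟨ mutate-away u w u≢K w≢K ⟩
    (q u w + q u K * q K w) ∸ (q w u + q w K * q K u)
      ≡⟨ cong₂ (λ x y → (q u w + x) ∸ (q w u + y)) (path-zero no-uKw) (path-zero no-wKu) ⟩
    (q u w + 0) ∸ (q w u + 0)
      ≡⟨ cong₂ _∸_ (ℕP.+-identityʳ (q u w)) (ℕP.+-identityʳ (q w u)) ⟩
    q u w ∸ q w u
      ≡⟨ cancel noTwo ⟩
    q u w ∎
    where
    open ≡-Reasoning
    cancel : ∀ {a b} → a ≡ 0 ⊎ b ≡ 0 → a ∸ b ≡ a
    cancel {b = b} (inj₁ refl) = ℕP.0∸n≡0 b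
    cancel (inj₂ refl) = refl

  mutate-keeps-apart : ∀ u w → u ≢ K → w ≢ K → q u K ≡ 0 ⊎ q K w ≡ 0 → q w K ≡ 0 ⊎ q K u ≡ 0 →
    Apart q u w → Apart q′ u w
  mutate-keeps-apart u w u≢K w≢K no-uKw no-wKu (uw≡0 , wu≡0) =
    trans (mutate-fixes u w u≢K w≢K no-uKw no-wKu (inj₁ uw≡0)) uw≡0 ,
    trans (mutate-fixes w u w≢K u≢K no-wKu no-uKw (inj₁ wu≡0)) wu≡0

  apart-from-k : ∀ w → w ≢ K → Apart q K w → Apart q′ K w
  apart-from-k w w≢K (Kw≡0 , wK≡0) = trans (mutate-from-k w) wK≡0 , trans (mutate-to-k w w≢K) Kw≡0

  signed-at-k : ∀ w → w ≢ K → signed q′ K w ≡ - signed q K w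
  signed-at-k w w≢K rewrite mutate-from-k w | mutate-to-k w w≢K = flip (+ q K w) (+ q w K)
    where
    flip : ∀ x y → y -ᶻ x ≡ - (x -ᶻ y)
    flip = solve-∀

  signed-away : ∀ u w → u ≢ K → w ≢ K → q w K ≡ 0 →
    signed q′ u w ≡ signed q u w +ᶻ + q u K *ᶻ signed q K w
  signed-away u w u≢K w≢K wK≡0 = begin
    signed q′ u w
      ≡⟨ cong₂ (λ x y → + x -ᶻ + y) (mutate-away u w u≢K w≢K) (mutate-away w u w≢K u≢K) ⟩
    + ((q u w + q u K * q K w) ∸ (q w u + q w K * q K u)) -ᶻ + ((q w u + q w K * q K u) ∸ (q u w + q u K * q K w))
      ≡⟨ truncated-difference (q u w + q u K * q K w) (q w u + q w K * q K u) ⟩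
    + (q u w + q u K * q K w) -ᶻ + (q w u + q w K * q K u)
      ≡⟨ cong (λ x → + (q u w + q u K * q K w) -ᶻ + (q w u + x * q K u)) wK≡0 ⟩
    + (q u w + q u K * q K w) -ᶻ + (q w u + 0)
      ≡⟨ cong₂ (λ x y → x -ᶻ + y) (trans (ℤP.pos-+ (q u w) _) (cong (+ q u w +ᶻ_) (ℤP.pos-* (q u K) (q K w))))
                                  (ℕP.+-identityʳ (q w u)) ⟩
    (+ q u w +ᶻ + q u K *ᶻ + q K w) -ᶻ + q w u
      ≡⟨ regroup (+ q u w) (+ q u K) (+ q K w) (+ q w u) ⟩
    signed q u w +ᶻ + q u K *ᶻ (+ q K w -ᶻ 0ℤ)
      ≡⟨ cong (λ x → signed q u w +ᶻ + q u K *ᶻ (+ q K w -ᶻ + x)) (sym wK≡0) ⟩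
    signed q u w +ᶻ + q u K *ᶻ signed q K w ∎
    where
    open ≡-Reasoning
    regroup : ∀ x a y z → (x +ᶻ a *ᶻ y) -ᶻ z ≡ (x -ᶻ z) +ᶻ a *ᶻ (y -ᶻ 0ℤ)
    regroup = solve-∀

liftIce : ∀ {p n} → (Fin p → Fin n) → IceV p → IceV n
liftIce g = Sum.map g g

restrict : ∀ {p n} → (Fin p → Fin n) → Arrows (IceV n) → Arrows (IceV p)
restrict g q u v = q (liftIce g u) (liftIce g v)

liftIce-≢ : ∀ {p n} {g : Fin p → Fin n} → Injective _≡_ _≡_ g →
  ∀ {u k} → u ≢ inj₁ k → liftIce g u ≢ inj₁ (g k)
liftIce-≢ g-inj {inj₁ i} u≢k e = u≢k (cong inj₁ (g-inj (inj₁-injective e)))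

mutate-restrict : ∀ {p n} {g : Fin p → Fin n} → Injective _≡_ _≡_ g →
  ∀ {q : Arrows (IceV n)} {q₁ : Arrows (IceV p)} k → (∀ u v → restrict g q u v ≡ q₁ u v) →
  ∀ u v → restrict g (mutate q (g k)) u v ≡ mutate q₁ k u v
mutate-restrict {g = g} g-inj {q} {q₁} k q≗q₁ u v = cases (u ≟V inj₁ k) (v ≟V inj₁ k)
  where
  module Q = Mutation q (g k)
  module Q₁ = Mutation q₁ k
  open ≡-Reasoning
  cases : Dec (u ≡ inj₁ k) → Dec (v ≡ inj₁ k) → restrict g (mutate q (g k)) u v ≡ mutate q₁ k u v
  cases (yes refl) _ = trans (Q.mutate-from-k (liftIce g v)) (trans (q≗q₁ v u) (sym (Q₁.mutate-from-k v)))
  cases (no u≢k) (yes refl) =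
    trans (Q.mutate-to-k (liftIce g u) (liftIce-≢ g-inj u≢k)) (trans (q≗q₁ v u) (sym (Q₁.mutate-to-k u u≢k)))
  cases (no u≢k) (no v≢k) = begin
    restrict g (mutate q (g k)) u v
      ≡⟨ Q.mutate-away (liftIce g u) (liftIce g v) (liftIce-≢ g-inj u≢k) (liftIce-≢ g-inj v≢k) ⟩
    (q (liftIce g u) (liftIce g v) + q (liftIce g u) Q.K * q Q.K (liftIce g v)) ∸
      (q (liftIce g v) (liftIce g u) + q (liftIce g v) Q.K * q Q.K (liftIce g u))
      ≡⟨ cong₂ _∸_ (paths u v) (paths v u) ⟩
    (q₁ u v + q₁ u Q₁.K * q₁ Q₁.K v) ∸ (q₁ v u + q₁ v Q₁.K * q₁ Q₁.K u)
      ≡⟨ sym (Q₁.mutate-away u v u≢k v≢k) ⟩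
    mutate q₁ k u v ∎
    where
    paths : ∀ x y → q (liftIce g x) (liftIce g y) + q (liftIce g x) Q.K * q Q.K (liftIce g y)
                  ≡ q₁ x y + q₁ x Q₁.K * q₁ Q₁.K y
    paths x y = cong₂ _+_ (q≗q₁ x y) (cong₂ _*_ (q≗q₁ x (inj₁ k)) (q≗q₁ (inj₁ k) y))

framed-diagonal : ∀ {p} (Q : Arrows (Fin p)) i → framed Q (inj₁ i) (inj₂ i) ≡ 1
framed-diagonal Q i with i ≟ i
... | yes _ = refl
... | no i≢i = ⊥-elim (i≢i refl)

framed-off-diagonal : ∀ {p} (Q : Arrows (Fin p)) i j → i ≢ j → framed Q (inj₁ i) (inj₂ j) ≡ 0
framed-off-diagonal Q i j i≢j with i ≟ j
... | yes i≡j = ⊥-elim (i≢j i≡j)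
... | no _ = refl

framed-apart : ∀ {p} (Q : Arrows (Fin p)) i j → i ≢ j → Apart (framed Q) (inj₁ i) (inj₂ j)
framed-apart Q i j i≢j = framed-off-diagonal Q i j i≢j , refl

framed-noTwoCycles : ∀ {p} {Q : Arrows (Fin p)} → NoTwoCycles Q → NoTwoCycles (framed Q)
framed-noTwoCycles noTwo (inj₁ i) (inj₁ j) = noTwo i j
framed-noTwoCycles noTwo (inj₁ i) (inj₂ j) = inj₂ refl
framed-noTwoCycles noTwo (inj₂ i) v = inj₁ refl

framed-signed-unit : ∀ {p} (Q : Arrows (Fin p)) (c : Fin p → ℕ) i →
  lincomb c (λ f → signed (framed Q) (inj₁ i) (inj₂ f)) ≡ + c i
framed-signed-unit Q c i = lincomb-unit c _ i (cong (λ x → + x -ᶻ 0ℤ) (framed-diagonal Q i))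
  (λ f f≢i → cong (λ x → + x -ᶻ 0ℤ) (framed-off-diagonal Q i f (f≢i ∘ sym)))

framed-restrict : ∀ {p n} {g : Fin p → Fin n} → Injective _≡_ _≡_ g →
  ∀ {Q : Arrows (Fin n)} {Q₁ : Arrows (Fin p)} → (∀ i j → Q (g i) (g j) ≡ Q₁ i j) →
  ∀ u v → restrict g (framed Q) u v ≡ framed Q₁ u v
framed-restrict g-inj Q≗Q₁ (inj₁ i) (inj₁ j) = Q≗Q₁ i j
framed-restrict {g = g} g-inj {Q} {Q₁} _ (inj₁ i) (inj₂ j) = cases (i ≟ j)
  where
  cases : Dec (i ≡ j) → framed Q (inj₁ (g i)) (inj₂ (g j)) ≡ framed Q₁ (inj₁ i) (inj₂ j)
  cases (yes refl) = trans (framed-diagonal Q (g i)) (sym (framed-diagonal Q₁ i))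
  cases (no i≢j) = trans (framed-off-diagonal Q (g i) (g j) (i≢j ∘ g-inj)) (sym (framed-off-diagonal Q₁ i j i≢j))
framed-restrict g-inj Q≗Q₁ (inj₂ i) v = refl

framed-frozen-apart : ∀ {p n} (Q : Arrows (Fin n)) {g : Fin p → Fin n} {j} →
  (∀ i → g i ≢ j) → ∀ u → Apart (framed Q) (liftIce g u) (inj₂ j)
framed-frozen-apart Q {j = j} g≢j (inj₁ i) = framed-apart Q _ j (g≢j i)
framed-frozen-apart Q g≢j (inj₂ i) = refl , refl

record Decomposition (n p r : ℕ) : Set where
  field
    ι₁ : Fin p → Fin n
    ι₂ : Fin r → Fin n
    ι₁-injective : Injective _≡_ _≡_ ι₁
    ι₂-injective : Injective _≡_ _≡_ ι₂
    disjoint : ∀ i j → ι₁ i ≢ ι₂ j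
    cover : ∀ v → (∃ λ i → ι₁ i ≡ v) ⊎ (∃ λ j → ι₂ j ≡ v)

swap : ∀ {n p r} → Decomposition n p r → Decomposition n r p
swap d = record
  { ι₁ = ι₂ ; ι₂ = ι₁ ; ι₁-injective = ι₂-injective ; ι₂-injective = ι₁-injective
  ; disjoint = λ i j → disjoint j i ∘ sym ; cover = Sum.swap ∘ cover }
  where open Decomposition d

module Phase {n p r : ℕ} (d : Decomposition n p r) (q₀ : Arrows (IceV n)) where
  open Decomposition d

  weight : Fin r → Fin p → ℕ
  weight b f = q₀ (inj₁ (ι₁ f)) (inj₁ (ι₂ b))

  frozenRow : Arrows (IceV n) → IceV n → Fin p → ℤ
  frozenRow q u f = signed q u (inj₂ (ι₁ f))

  record Invariant (q : Arrows (IceV n)) (qA : Arrows (IceV p)) : Set where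
    field
      noTwoCycles : NoTwoCycles q
      active : ∀ u v → restrict ι₁ q u v ≡ qA u v
      passive : ∀ u v → restrict ι₂ q u v ≡ restrict ι₂ q₀ u v
      passive-frozen-apart : ∀ u y → Apart q (liftIce ι₁ u) (inj₂ (ι₂ y))
      active-frozen-apart : ∀ f v → Apart q (inj₂ (ι₁ f)) (liftIce ι₂ v)
      cone : ∀ k b → signed q (inj₁ (ι₁ k)) (inj₁ (ι₂ b)) ≡ lincomb (weight b) (frozenRow q (inj₁ (ι₁ k)))

  initial : ∀ {Q : Arrows (Fin p)} → NoTwoCycles q₀ → (∀ u v → restrict ι₁ q₀ u v ≡ framed Q u v) →
    (∀ u y → Apart q₀ (liftIce ι₁ u) (inj₂ (ι₂ y))) → (∀ f v → Apart q₀ (inj₂ (ι₁ f)) (liftIce ι₂ v)) →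
    (∀ b k → q₀ (inj₁ (ι₂ b)) (inj₁ (ι₁ k)) ≡ 0) → Invariant q₀ (framed Q)
  initial {Q} noTwo framedA apartP apartA no-back = record
    { noTwoCycles = noTwo ; active = framedA ; passive = λ _ _ → refl
    ; passive-frozen-apart = apartP ; active-frozen-apart = apartA ; cone = cone }
    where
    cone : ∀ k b → signed q₀ (inj₁ (ι₁ k)) (inj₁ (ι₂ b)) ≡ lincomb (weight b) (frozenRow q₀ (inj₁ (ι₁ k)))
    cone k b = begin
      signed q₀ (inj₁ (ι₁ k)) (inj₁ (ι₂ b))
        ≡⟨ cong (λ x → + weight b k -ᶻ + x) (no-back b k) ⟩
      + weight b k -ᶻ 0ℤ
        ≡⟨ ℤP.+-identityʳ (+ weight b k) ⟩
      + weight b k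
        ≡⟨ sym (framed-signed-unit Q (weight b) k) ⟩
      lincomb (weight b) (λ f → signed (framed Q) (inj₁ k) (inj₂ f))
        ≡⟨ lincomb-cong (weight b) (λ f → sym (cong₂ (λ x y → + x -ᶻ + y)
                                                      (framedA (inj₁ k) (inj₂ f)) (framedA (inj₂ f) (inj₁ k)))) ⟩
      lincomb (weight b) (frozenRow q₀ (inj₁ (ι₁ k))) ∎
      where open ≡-Reasoning

  module Step {q : Arrows (IceV n)} {qA : Arrows (IceV p)} (I : Invariant q qA) (k : Fin p) (green : Green qA k) where
    open Invariant I
    open Mutation q (ι₁ k)

    frozen-not-into-k : ∀ f → q (inj₂ f) K ≡ 0
    frozen-not-into-k f with cover f
    ... | inj₁ (a , refl) = trans (active (inj₂ a) (inj₁ k)) (green a)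
    ... | inj₂ (b , refl) = proj₂ (passive-frozen-apart (inj₁ k) b)

    -- the passive columns inherit the nonnegativity of the frozen row of k
    passive-not-into-k : ∀ b → q (inj₁ (ι₂ b)) K ≡ 0
    passive-not-into-k b = nonneg-no-reverse q (noTwoCycles K (inj₁ (ι₂ b)))
      (subst (0ℤ ≤_) (sym (cone k b))
             (lincomb-nonneg (weight b) (λ f → signed-nonneg q (frozen-not-into-k (ι₁ f)))))

    lifted-passive-not-into-k : ∀ v → q (liftIce ι₂ v) K ≡ 0
    lifted-passive-not-into-k (inj₁ b) = passive-not-into-k b
    lifted-passive-not-into-k (inj₂ y) = frozen-not-into-k (ι₂ y)

    passive≢k : ∀ v → liftIce ι₂ v ≢ K
    passive≢k (inj₁ b) e = disjoint k b (sym (inj₁-injective e))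

    active≢k : ∀ {u} → u ≢ inj₁ k → liftIce ι₁ u ≢ K
    active≢k = liftIce-≢ ι₁-injective

    -- there are no 2-paths through k inside the passive block, nor between a frozen
    -- vertex of one block and the other block, so these parts are unchanged
    passive′ : ∀ u v → restrict ι₂ q′ u v ≡ restrict ι₂ q₀ u v
    passive′ u v = trans (mutate-fixes _ _ (passive≢k u) (passive≢k v)
                            (inj₁ (lifted-passive-not-into-k u)) (inj₁ (lifted-passive-not-into-k v))
                            (noTwoCycles _ _))
                         (passive u v)

    passive-frozen-apart′ : ∀ u y → Apart q′ (liftIce ι₁ u) (inj₂ (ι₂ y))
    passive-frozen-apart′ u y with u ≟V inj₁ k
    ... | yes refl = apart-from-k (inj₂ (ι₂ y)) (λ ()) (passive-frozen-apart (inj₁ k) y)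
    ... | no u≢k = mutate-keeps-apart _ _ (active≢k u≢k) (λ ()) (inj₂ (proj₁ (passive-frozen-apart (inj₁ k) y)))
                     (inj₁ (proj₂ (passive-frozen-apart (inj₁ k) y))) (passive-frozen-apart u y)

    active-frozen-apart′ : ∀ f v → Apart q′ (inj₂ (ι₁ f)) (liftIce ι₂ v)
    active-frozen-apart′ f v = mutate-keeps-apart _ _ (λ ()) (passive≢k v)
      (inj₁ (frozen-not-into-k (ι₁ f))) (inj₁ (lifted-passive-not-into-k v)) (active-frozen-apart f v)

    -- at k all entries change sign, so the combination is negated
    cone-at-k : ∀ b → signed q′ K (inj₁ (ι₂ b)) ≡ lincomb (weight b) (frozenRow q′ K)
    cone-at-k b = begin
      signed q′ K (inj₁ (ι₂ b))                 ≡⟨ signed-at-k (inj₁ (ι₂ b)) (passive≢k (inj₁ b)) ⟩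
      - signed q K (inj₁ (ι₂ b))                ≡⟨ cong -_ (cone k b) ⟩
      - lincomb (weight b) (frozenRow q K)      ≡⟨ sym (lincomb-neg (weight b) (frozenRow q K)) ⟩
      lincomb (weight b) (-_ ∘ frozenRow q K)   ≡⟨ lincomb-cong (weight b) (λ f → sym (signed-at-k _ (λ ()))) ⟩
      lincomb (weight b) (frozenRow q′ K)       ∎
      where open ≡-Reasoning

    -- elsewhere mutation adds q U K times the row of k; this is linear on the passive
    -- and frozen columns because none of those vertices has an arrow into k
    cone-away : ∀ k′ b → k′ ≢ k →
      signed q′ (inj₁ (ι₁ k′)) (inj₁ (ι₂ b)) ≡ lincomb (weight b) (frozenRow q′ (inj₁ (ι₁ k′)))
    cone-away k′ b k′≢k = begin
      signed q′ U (inj₁ (ι₂ b))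
        ≡⟨ signed-away U (inj₁ (ι₂ b)) U≢K (passive≢k (inj₁ b)) (passive-not-into-k b) ⟩
      signed q U (inj₁ (ι₂ b)) +ᶻ + q U K *ᶻ signed q K (inj₁ (ι₂ b))
        ≡⟨ cong₂ (λ x y → x +ᶻ + q U K *ᶻ y) (cone k′ b) (cone k b) ⟩
      lincomb (weight b) (frozenRow q U) +ᶻ + q U K *ᶻ lincomb (weight b) (frozenRow q K)
        ≡⟨ sym (lincomb-linear (weight b) (frozenRow q U) (frozenRow q K) (+ q U K)) ⟩
      lincomb (weight b) (λ f → frozenRow q U f +ᶻ + q U K *ᶻ frozenRow q K f)
        ≡⟨ lincomb-cong (weight b) (λ f → sym (signed-away U _ U≢K (λ ()) (frozen-not-into-k (ι₁ f)))) ⟩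
      lincomb (weight b) (frozenRow q′ U) ∎
      where
      open ≡-Reasoning
      U : IceV n
      U = inj₁ (ι₁ k′)
      U≢K : U ≢ K
      U≢K = active≢k (k′≢k ∘ inj₁-injective)

    cone′ : ∀ k′ b → signed q′ (inj₁ (ι₁ k′)) (inj₁ (ι₂ b)) ≡ lincomb (weight b) (frozenRow q′ (inj₁ (ι₁ k′)))
    cone′ k′ b with k′ ≟ k
    ... | yes refl = cone-at-k b
    ... | no k′≢k = cone-away k′ b k′≢k

    invariant : Invariant q′ (mutate qA k)
    invariant = record
      { noTwoCycles = mutate-noTwoCycles noTwoCycles
      ; active = mutate-restrict ι₁-injective k active
      ; passive = passive′
      ; passive-frozen-apart = passive-frozen-apart′
      ; active-frozen-apart = active-frozen-apart′
      ; cone = cone′ }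

  phase : ∀ {q qA μ} → GreenSeq qA μ → Invariant q qA →
    GreenSeq q (map ι₁ μ) × Invariant (mutateSeq q (map ι₁ μ)) (mutateSeq qA μ)
  phase [] I = [] , I
  phase {μ = k ∷ μ} (green ∷ greens) I with phase greens (Step.invariant I k green)
  ... | greens′ , I′ = Step.frozen-not-into-k I k green ∷ greens′ , I′

  red-active-block : ∀ {q qA} → Invariant q qA → (∀ i → Red qA i) →
    ∀ i b → q (inj₁ (ι₁ i)) (inj₁ (ι₂ b)) ≡ 0
  red-active-block {q} I red i b = nonpos-no-forward q (noTwoCycles _ _)
    (subst (_≤ 0ℤ) (sym (cone i b))
           (lincomb-nonpos (weight b) (λ f → signed-nonpos q (trans (active (inj₁ i) (inj₂ f)) (red i f)))))
    where open Invariant I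

mutateSeq-++ : ∀ {n} (q : Arrows (IceV n)) μ₁ μ₂ → mutateSeq q (μ₁ ++ μ₂) ≡ mutateSeq (mutateSeq q μ₁) μ₂
mutateSeq-++ q [] μ₂ = refl
mutateSeq-++ q (k ∷ μ₁) μ₂ = mutateSeq-++ (mutate q k) μ₁ μ₂

GreenSeq-++ : ∀ {n} {q : Arrows (IceV n)} μ₁ {μ₂} →
  GreenSeq q μ₁ → GreenSeq (mutateSeq q μ₁) μ₂ → GreenSeq q (μ₁ ++ μ₂)
GreenSeq-++ [] [] greens₂ = greens₂
GreenSeq-++ (k ∷ μ₁) (green ∷ greens₁) greens₂ = green ∷ GreenSeq-++ μ₁ greens₁ greens₂

record Triangular {n p r} (d : Decomposition n p r)
                  (Q : Arrows (Fin n)) (Q₁ : Arrows (Fin p)) (Q₂ : Arrows (Fin r)) : Set where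
  open Decomposition d
  field
    first : ∀ i j → Q (ι₁ i) (ι₁ j) ≡ Q₁ i j
    second : ∀ i j → Q (ι₂ i) (ι₂ j) ≡ Q₂ i j
    no-back : ∀ i j → Q (ι₂ i) (ι₁ j) ≡ 0

triangular-noTwoCycles : ∀ {n p r} {d : Decomposition n p r} {Q Q₁ Q₂} → Triangular d Q Q₁ Q₂ →
  NoTwoCycles Q₁ → NoTwoCycles Q₂ → NoTwoCycles Q
triangular-noTwoCycles {d = d} {Q} T noTwo₁ noTwo₂ u v = cases (cover u) (cover v)
  where
  open Decomposition d
  open Triangular T
  cases : (∃ λ i → ι₁ i ≡ u) ⊎ (∃ λ j → ι₂ j ≡ u) → (∃ λ i → ι₁ i ≡ v) ⊎ (∃ λ j → ι₂ j ≡ v) →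
    Q u v ≡ 0 ⊎ Q v u ≡ 0
  cases (inj₁ (i , refl)) (inj₁ (j , refl)) = Sum.map (trans (first i j)) (trans (first j i)) (noTwo₁ i j)
  cases (inj₂ (i , refl)) (inj₂ (j , refl)) = Sum.map (trans (second i j)) (trans (second j i)) (noTwo₂ i j)
  cases (inj₁ (i , refl)) (inj₂ (j , refl)) = inj₂ (no-back j i)
  cases (inj₂ (i , refl)) (inj₁ (j , refl)) = inj₁ (no-back i j)

module Concatenation {n p r} (d : Decomposition n p r) {Q Q₁ Q₂} (T : Triangular d Q Q₁ Q₂)
  (noTwo₁ : NoTwoCycles Q₁) (noTwo₂ : NoTwoCycles Q₂)
  {μ₁ μ₂} (maxGreen₁ : MaxGreen Q₁ μ₁) (maxGreen₂ : MaxGreen Q₂ μ₂) where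
  open Decomposition d
  open Triangular T

  module P₁ = Phase d (framed Q)

  start : P₁.Invariant (framed Q) (framed Q₁)
  start = P₁.initial (framed-noTwoCycles (triangular-noTwoCycles T noTwo₁ noTwo₂))
    (framed-restrict ι₁-injective first)
    (λ u y → framed-frozen-apart Q (λ i → disjoint i y) u)
    (λ f v → Data.Product.swap (framed-frozen-apart Q (λ j e → disjoint f j (sym e)) v))
    no-back

  q₁ : Arrows (IceV n)
  q₁ = mutateSeq (framed Q) (map ι₁ μ₁)

  first-phase : GreenSeq (framed Q) (map ι₁ μ₁) × P₁.Invariant q₁ (mutateSeq (framed Q₁) μ₁)
  first-phase = P₁.phase (proj₁ maxGreen₁) start

  module I₁ = P₁.Invariant (proj₂ first-phase)

  -- second phase: the blocks exchange roles; the first block is now red, so no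
  -- arrows lead from it to the (still framed) second block
  module P₂ = Phase (swap d) q₁

  middle : P₂.Invariant q₁ (framed Q₂)
  middle = P₂.initial I₁.noTwoCycles
    (λ u v → trans (I₁.passive u v) (framed-restrict ι₂-injective second u v))
    (λ u y → Data.Product.swap (I₁.active-frozen-apart y u))
    (λ f v → Data.Product.swap (I₁.passive-frozen-apart v f))
    (P₁.red-active-block (proj₂ first-phase) (proj₂ maxGreen₁))

  q₂ : Arrows (IceV n)
  q₂ = mutateSeq q₁ (map ι₂ μ₂)

  second-phase : GreenSeq q₁ (map ι₂ μ₂) × P₂.Invariant q₂ (mutateSeq (framed Q₂) μ₂)
  second-phase = P₂.phase (proj₁ maxGreen₂) middle

  module I₂ = P₂.Invariant (proj₂ second-phase)

  all-red : ∀ i → Red q₂ i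
  all-red i f with cover i | cover f
  ... | inj₂ (k , refl) | inj₂ (g , refl) = trans (I₂.active (inj₁ k) (inj₂ g)) (proj₂ maxGreen₂ k g)
  ... | inj₂ (k , refl) | inj₁ (g , refl) = proj₁ (I₂.passive-frozen-apart (inj₁ k) g)
  ... | inj₁ (k , refl) | inj₂ (g , refl) = proj₂ (I₂.active-frozen-apart g (inj₁ k))
  ... | inj₁ (k , refl) | inj₁ (g , refl) =
    trans (I₂.passive (inj₁ k) (inj₂ g)) (trans (I₁.active (inj₁ k) (inj₂ g)) (proj₂ maxGreen₁ k g))

  maxGreen : MaxGreen Q (map ι₁ μ₁ ++ map ι₂ μ₂)
  maxGreen = GreenSeq-++ (map ι₁ μ₁) (proj₁ first-phase) (proj₁ second-phase)
           , λ i → subst (λ q → Red q i) (sym (mutateSeq-++ (framed Q) (map ι₁ μ₁) (map ι₂ μ₂))) (all-red i)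

sumDecomposition : (N₁ N₂ : ℕ) → Decomposition (N₁ + N₂) N₁ N₂
sumDecomposition N₁ N₂ = record
  { ι₁ = _↑ˡ N₂ ; ι₂ = N₁ ↑ʳ_
  ; ι₁-injective = ↑ˡ-injective N₂ _ _ ; ι₂-injective = ↑ʳ-injective N₁ _ _
  ; disjoint = disjoint ; cover = cover }
  where
  disjoint : ∀ i j → i ↑ˡ N₂ ≢ N₁ ↑ʳ j
  disjoint i j e with trans (sym (splitAt-↑ˡ N₁ i N₂)) (trans (cong (splitAt N₁) e) (splitAt-↑ʳ N₁ N₂ j))
  ... | ()
  cover : ∀ v → (∃ λ i → i ↑ˡ N₂ ≡ v) ⊎ (∃ λ j → N₁ ↑ʳ j ≡ v)
  cover v with splitAt N₁ v in eq
  ... | inj₁ i = inj₁ (i , splitAt⁻¹-↑ˡ eq)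
  ... | inj₂ j = inj₂ (j , splitAt⁻¹-↑ʳ eq)

directSum-triangular : ∀ N₁ N₂ s Q₁ Q₂ a B →
  Triangular (sumDecomposition N₁ N₂) (directSum N₁ N₂ s Q₁ Q₂ a B) Q₁ Q₂
directSum-triangular N₁ N₂ s Q₁ Q₂ a B = record { first = first ; second = second ; no-back = no-back }
  where
  first : ∀ i j → directSum N₁ N₂ s Q₁ Q₂ a B (i ↑ˡ N₂) (j ↑ˡ N₂) ≡ Q₁ i j
  first i j rewrite splitAt-↑ˡ N₁ i N₂ | splitAt-↑ˡ N₁ j N₂ = refl
  second : ∀ i j → directSum N₁ N₂ s Q₁ Q₂ a B (N₁ ↑ʳ i) (N₁ ↑ʳ j) ≡ Q₂ i j
  second i j rewrite splitAt-↑ʳ N₁ N₂ i | splitAt-↑ʳ N₁ N₂ j = refl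
  no-back : ∀ i j → directSum N₁ N₂ s Q₁ Q₂ a B (N₁ ↑ʳ i) (j ↑ˡ N₂) ≡ 0
  no-back i j rewrite splitAt-↑ʳ N₁ N₂ i | splitAt-↑ˡ N₁ j N₂ = refl

proposition3p14 : (N₁ N₂ s : ℕ) (Q₁ : Arrows (Fin N₁)) (Q₂ : Arrows (Fin N₂))
    → IsQuiver Q₁ → IsQuiver Q₂
    → (a : Fin s → Fin N₁) → Injective _≡_ _≡_ a
    → (B : Fin s → Subset N₂)
    → (μ₁ : List (Fin N₁)) (μ₂ : List (Fin N₂))
    → MaxGreen Q₁ μ₁ → MaxGreen Q₂ μ₂
    → MaxGreen (directSum N₁ N₂ s Q₁ Q₂ a B) (embed₁ N₂ μ₁ ++ embed₂ N₁ μ₂)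
proposition3p14 N₁ N₂ s Q₁ Q₂ isQuiver₁ isQuiver₂ a _ B μ₁ μ₂ maxGreen₁ maxGreen₂ =
  Concatenation.maxGreen (sumDecomposition N₁ N₂) (directSum-triangular N₁ N₂ s Q₁ Q₂ a B)
    (proj₂ isQuiver₁) (proj₂ isQuiver₂) maxGreen₁ maxGreen₂
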